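{- Let $p$ be an odd prime and let $\alpha,\beta$ be positive integers, and put $n=2^{\alpha}p^{\beta}$. Then $n$ is a Zumkeller number if and only if $p\leq 2^{\alpha+1}-1$ and $\beta$ is odd.
   Context: A positive integer $n$ is a Zumkeller number if the set of its positive divisors can be partitioned into two disjoint subsets with equal sums (each sum then equals $\sigma(n)/2$, where $\sigma(n)$ is the sum of the positive divisors of $n$). -}

module Defs where

open import Data.Nat using (ℕ; suc; _+_; _*_)
open import Data.Nat.Divisibility using (_∣?_)
open import Data.List using (List; filter; _++_; applyUpTo)
open import Data.Nat.ListAction using (sum)
open import Data.List.Relation.Binary.Permutation.Propositional using (_↭_)
open import Data.Product using (Σ; _×_; ∃₂)
open import Relation.Binary.PropositionalEquality using (_≡_)

divisors : ℕ → List ℕ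
divisors n = filter (_∣? n) (applyUpTo suc n)

-- Since the divisor list has no repetitions, a permutation A ++ B ↭ divisors n
-- is exactly a partition into two disjoint subsets A, B.
Zumkeller : ℕ → Set
Zumkeller n = ∃₂ λ (A B : List ℕ) → (A ++ B ↭ divisors n) × (sum A ≡ sum B)

OddNat : ℕ → Set
OddNat b = Σ ℕ λ k → b ≡ suc (2 * k)

module Submission where

open import Defs
open import Data.Nat using (ℕ; zero; suc; _+_; _*_; _^_; _≤_; _<_; _∸_; z≤n; s≤s; NonZero; ≢-nonZero⁻¹)
open import Data.Nat.Properties
open import Data.Nat.Divisibility
open import Data.Nat.Coprimality using (Coprime; coprime-divisor)
open import Data.Nat.Primality using (Prime; prime[2]; ¬prime[1]; prime⇒irreducible; prime⇒nonZero; euclidsLemma)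
open import Data.Nat.Tactic.RingSolver using (solve-∀)
open import Data.Nat.ListAction using (sum)
open import Data.Nat.ListAction.Properties using (sum-++; sum-↭)
open import Data.List using (List; []; _∷_; _++_; map; applyUpTo)
import Data.List.Properties as ListProp
open import Data.List.Membership.Propositional using (_∈_)
open import Data.List.Membership.Propositional.Properties
  using (∈-++⁻; ∈-++⁺ˡ; ∈-++⁺ʳ; ∈-map⁺; ∈-map⁻; ∈-filter⁺; ∈-filter⁻; ∈-applyUpTo⁺)
open import Data.List.Membership.Propositional.Properties.WithK using (unique∧set⇒bag)
open import Data.List.Relation.Unary.Any using (here; there)
import Data.List.Relation.Unary.All as All
open import Data.List.Relation.Unary.AllPairs using ([]; _∷_)
open import Data.List.Relation.Unary.Unique.Propositional using (Unique)
import Data.List.Relation.Unary.Unique.Propositional.Properties as Unique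
open import Data.List.Relation.Binary.BagAndSetEquality using (∼bag⇒↭)
open import Data.List.Relation.Binary.Permutation.Propositional
  using (_↭_; ↭-refl; ↭-sym; ↭-trans; ↭-reflexive; prep)
open import Data.List.Relation.Binary.Permutation.Propositional.Properties
  using (shift; shifts; ++⁺; ++⁺ˡ; ∈-resp-↭)
  renaming (map⁺ to ↭-map⁺)
open import Data.Product using (∃; ∃₂; _×_; _,_; proj₂)
open import Data.Sum using (_⊎_; inj₁; inj₂)
open import Function.Bundles using (_⇔_; mk⇔; Equivalence)
import Function.Properties.Equivalence as ⇔
open import Relation.Nullary using (¬_; yes; no; contradiction)
open import Relation.Binary.PropositionalEquality
  using (_≡_; refl; sym; trans; cong; cong₂; subst; module ≡-Reasoning)

-- Write p = 2r + 1 and s = 1 + 2 + … + 2 ^ α = 2 ^ (α + 1) - 1 = 2y + 1.  The divisors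
-- of n = 2 ^ α · p ^ β form the "layers" p ^ β·P ++ … ++ p·P ++ P over the list P of
-- powers of two 2 ^ i, i ≤ α (a divisor list is unique up to permutation, and q-adic
-- valuations are unique), so n is Zumkeller iff this list is Balanced: it splits into
-- two parts of equal sum.  This is decided for layers over any complete list P
-- (every number up to sum P is a sub-sum) with odd total and an element above half
-- of it (layers-balanced⇔):
--   * necessity: the total (1 + p + … + p ^ β) · s must be even, which forces β odd;
--     and the top element p ^ β · 2 ^ α is at most half the total, forcing p ≤ s;
--   * sufficiency: two consecutive layers balance, taking sub-sums y and r + y + 1 of P,
--     and β + 1 layers (β odd) are a union of scaled copies of the bottom pair.

even-or-odd : ∀ m → 2 ∣ m ⊎ OddNat m
even-or-odd zero = inj₁ (divides 0 refl)
even-or-odd (suc m) with even-or-odd m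
... | inj₁ (divides k refl) = inj₂ (k , cong suc (*-comm k 2))
... | inj₂ (k , refl)       = inj₁ (divides (suc k) (cong (λ x → suc (suc x)) (*-comm 2 k)))

odd⇒∤2 : ∀ {m} → OddNat m → ¬ 2 ∣ m
odd⇒∤2 (k , refl) (divides q eq) = even≢odd q k (trans (*-comm 2 q) (sym eq))

∤2⇒odd : ∀ {m} → ¬ 2 ∣ m → OddNat m
∤2⇒odd {m} 2∤m with even-or-odd m
... | inj₁ 2∣m = contradiction 2∣m 2∤m
... | inj₂ odd = odd

Splits : List ℕ → ℕ → Set
Splits L x = ∃₂ λ (A B : List ℕ) → (A ++ B ↭ L) × (sum A ≡ x)

Balanced : List ℕ → Set
Balanced L = ∃₂ λ (A B : List ℕ) → (A ++ B ↭ L) × (sum A ≡ sum B)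

sum-split : ∀ (A : List ℕ) {B L} → A ++ B ↭ L → sum A + sum B ≡ sum L
sum-split A {B} π = trans (sym (sum-++ A B)) (sum-↭ π)

sum-scale : ∀ c xs → sum (map (c *_) xs) ≡ c * sum xs
sum-scale c [] = sym (*-zeroʳ c)
sum-scale c (x ∷ xs) =
  trans (cong (c * x +_) (sum-scale c xs)) (sym (*-distribˡ-+ c x (sum xs)))

split-++ : ∀ (A B : List ℕ) {L} (A′ B′ : List ℕ) {L′} → A ++ B ↭ L → A′ ++ B′ ↭ L′ →
           (A ++ A′) ++ (B ++ B′) ↭ L ++ L′
split-++ A B A′ B′ π π′ = ↭-trans regroup (++⁺ π π′)
  where
  open ListProp using (++-assoc)
  regroup : (A ++ A′) ++ (B ++ B′) ↭ (A ++ B) ++ (A′ ++ B′)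
  regroup = ↭-trans (↭-reflexive (++-assoc A A′ (B ++ B′)))
            (↭-trans (++⁺ˡ A (shifts A′ B))
                     (↭-reflexive (sym (++-assoc A B (A′ ++ B′)))))

split-map : ∀ (f : ℕ → ℕ) (A B : List ℕ) {L} → A ++ B ↭ L → map f A ++ map f B ↭ map f L
split-map f A B π = subst (_↭ _) (ListProp.map-++ f A B) (↭-map⁺ f π)

Splits-++ : ∀ {L L′ x x′} → Splits L x → Splits L′ x′ → Splits (L ++ L′) (x + x′)
Splits-++ (A , B , π , e) (A′ , B′ , π′ , e′) =
  A ++ A′ , B ++ B′ , split-++ A B A′ B′ π π′ , trans (sum-++ A A′) (cong₂ _+_ e e′)

Splits-scale : ∀ c {L x} → Splits L x → Splits (map (c *_) L) (c * x)
Splits-scale c (A , B , π , e) =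
  map (c *_) A , map (c *_) B , split-map (c *_) A B π , trans (sum-scale c A) (cong (c *_) e)

half-Splits⇒Balanced : ∀ {L x} → Splits L x → x + x ≡ sum L → Balanced L
half-Splits⇒Balanced {L} {x} (A , B , π , refl) half =
  A , B , π , sym (+-cancelˡ-≡ (sum A) (sum B) (sum A) (trans (sum-split A π) (sym half)))

Balanced-++ : ∀ {L L′} → Balanced L → Balanced L′ → Balanced (L ++ L′)
Balanced-++ (A , B , π , e) (A′ , B′ , π′ , e′) =
  A ++ A′ , B ++ B′ , split-++ A B A′ B′ π π′ ,
  trans (sum-++ A A′) (trans (cong₂ _+_ e e′) (sym (sum-++ B B′)))

Balanced-scale : ∀ c {L} → Balanced L → Balanced (map (c *_) L)
Balanced-scale c (A , B , π , e) =
  map (c *_) A , map (c *_) B , split-map (c *_) A B π ,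
  trans (sum-scale c A) (trans (cong (c *_) e) (sym (sum-scale c B)))

Balanced-↭ : ∀ {L M} → L ↭ M → Balanced L → Balanced M
Balanced-↭ σ (A , B , π , e) = A , B , ↭-trans π σ , e

Balanced⇒2∣sum : ∀ {L} → Balanced L → 2 ∣ sum L
Balanced⇒2∣sum (A , B , π , e) =
  divides (sum A) (trans (sym (sum-split A π)) (trans (cong (sum A +_) (sym e)) (twice (sum A))))
  where twice : ∀ a → a + a ≡ a * 2
        twice a = trans (cong (a +_) (sym (+-identityʳ a))) (*-comm 2 a)

∈⇒≤sum : ∀ {x} xs → x ∈ xs → x ≤ sum xs
∈⇒≤sum (y ∷ xs) (here refl) = m≤m+n y (sum xs)
∈⇒≤sum (y ∷ xs) (there x∈) = ≤-trans (∈⇒≤sum xs x∈) (m≤n+m (sum xs) y)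

Balanced⇒≤half : ∀ {L x} → Balanced L → x ∈ L → x + x ≤ sum L
Balanced⇒≤half {x = x} (A , B , π , e) x∈L
  with ∈-++⁻ A (∈-resp-↭ (↭-sym π) x∈L)
... | inj₁ x∈A = subst (x + x ≤_) (trans (cong (sum A +_) e) (sum-split A π))
                   (+-mono-≤ (∈⇒≤sum A x∈A) (∈⇒≤sum A x∈A))
... | inj₂ x∈B = subst (x + x ≤_) (trans (cong (_+ sum B) (sym e)) (sum-split A π))
                   (+-mono-≤ (∈⇒≤sum B x∈B) (∈⇒≤sum B x∈B))

Complete : List ℕ → Set
Complete L = ∀ x → x ≤ sum L → Splits L x

complete-[] : Complete []
complete-[] zero _ = [] , [] , ↭-refl , refl

complete-∷ : ∀ {c L} → Complete L → c ≤ suc (sum L) → Complete (c ∷ L)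
complete-∷ {c} {L} complete c≤ x x≤ with c ≤? x
... | yes c≤x with complete (x ∸ c) (m≤n+o⇒m∸n≤o x c x≤)
...   | A , B , π , e = c ∷ A , B , prep c π , trans (cong (c +_) e) (m+[n∸m]≡n c≤x)
complete-∷ {c} {L} complete c≤ x x≤
    | no c≰x with complete x (m<1+n⇒m≤n (<-≤-trans (≰⇒> c≰x) c≤))
...   | A , B , π , e = A , c ∷ B , ↭-trans (shift c A B) (prep c π) , e

geomSum : ℕ → ℕ → ℕ
geomSum q zero    = 1
geomSum q (suc k) = q ^ suc k + geomSum q k

geomSum-closed : ∀ c k → geomSum (suc c) k * c + 1 ≡ suc c ^ suc k
geomSum-closed c zero = base c
  where base : ∀ c → 1 * c + 1 ≡ suc c * 1
        base = solve-∀
geomSum-closed c (suc k) = begin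
  (X + geomSum (suc c) k) * c + 1    ≡⟨ regroup X (geomSum (suc c) k) c ⟩
  X * c + (geomSum (suc c) k * c + 1) ≡⟨ cong (X * c +_) (geomSum-closed c k) ⟩
  X * c + X                          ≡⟨ factor X c ⟩
  suc c * X                          ∎
  where
  open ≡-Reasoning
  X : ℕ
  X = suc c ^ suc k
  regroup : ∀ X G c → (X + G) * c + 1 ≡ X * c + (G * c + 1)
  regroup = solve-∀
  factor : ∀ X c → X * c + X ≡ suc c * X
  factor = solve-∀

geomSum-bound : ∀ {q s} k → s < q → geomSum q k * s < q ^ suc k
geomSum-bound {suc c} {s} k (s≤s s≤c) = begin-strict
  geomSum (suc c) k * s     ≤⟨ *-monoʳ-≤ (geomSum (suc c) k) s≤c ⟩
  geomSum (suc c) k * c     <⟨ m<m+n (geomSum (suc c) k * c) (s≤s z≤n) ⟩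
  geomSum (suc c) k * c + 1 ≡⟨ geomSum-closed c k ⟩
  suc c ^ suc k             ∎
  where open ≤-Reasoning

geomSum-even-index : ∀ {q} → 2 ∣ suc q → ∀ m → ¬ 2 ∣ geomSum q (2 * m)
geomSum-even-index _ zero (divides k eq) = even≢odd k 0 (trans (*-comm 2 k) (sym eq))
geomSum-even-index {q} 2∣q+1 (suc m) 2∣G =
  geomSum-even-index 2∣q+1 m (∣m+n∣m⇒∣n 2∣G′ 2∣pair)
  where
  j : ℕ
  j = 2 * m
  -- the two top powers q^(j+2) + q^(j+1) = (q + 1) · q^(j+1) pair up to an even number
  pair≡ : q ^ suc (suc j) + q ^ suc j ≡ suc q * q ^ suc j
  pair≡ = +-comm (q * q ^ suc j) (q ^ suc j)
  2∣pair : 2 ∣ q ^ suc (suc j) + q ^ suc j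
  2∣pair = subst (2 ∣_) (sym pair≡) (∣m⇒∣m*n (q ^ suc j) 2∣q+1)
  2∣G′ : 2 ∣ (q ^ suc (suc j) + q ^ suc j) + geomSum q j
  2∣G′ = subst (2 ∣_) (sym (+-assoc (q ^ suc (suc j)) (q ^ suc j) (geomSum q j)))
         (subst (λ i → 2 ∣ geomSum q i) (*-suc 2 m) 2∣G)

geomSum-even⇒odd : ∀ {q k} → 2 ∣ suc q → 2 ∣ geomSum q k → OddNat k
geomSum-even⇒odd {q} {k} 2∣q+1 2∣G with even-or-odd k
... | inj₁ (divides m refl) =
      contradiction (subst (λ i → 2 ∣ geomSum q i) (*-comm m 2) 2∣G) (geomSum-even-index 2∣q+1 m)
... | inj₂ odd = odd

-- Layers: the list  q^k·L ++ … ++ q·L ++ q⁰·L.  The divisors of m · q ^ k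
-- (q a prime not dividing m) are the layers over the divisors of m.

layer : ℕ → List ℕ → ℕ → List ℕ
layer q L j = map (q ^ j *_) L

layers : ℕ → List ℕ → ℕ → List ℕ
layers q L zero    = layer q L 0
layers q L (suc k) = layer q L (suc k) ++ layers q L k

sum-layers : ∀ q L k → sum (layers q L k) ≡ geomSum q k * sum L
sum-layers q L zero = sum-scale 1 L
sum-layers q L (suc k) = begin
  sum (layer q L (suc k) ++ layers q L k)        ≡⟨ sum-++ (layer q L (suc k)) (layers q L k) ⟩
  sum (layer q L (suc k)) + sum (layers q L k)   ≡⟨ cong₂ _+_ (sum-scale (q ^ suc k) L) (sum-layers q L k) ⟩
  q ^ suc k * sum L + geomSum q k * sum L        ≡⟨ sym (*-distribʳ-+ (sum L) (q ^ suc k) (geomSum q k)) ⟩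
  geomSum q (suc k) * sum L                      ∎
  where open ≡-Reasoning

∈-layers⁻ : ∀ {q L d} k → d ∈ layers q L k → ∃₂ λ j e → j ≤ k × e ∈ L × d ≡ q ^ j * e
∈-layers⁻ zero d∈ with ∈-map⁻ _ d∈
... | e , e∈L , refl = 0 , e , z≤n , e∈L , refl
∈-layers⁻ {q} {L} (suc k) d∈ with ∈-++⁻ (layer q L (suc k)) d∈
... | inj₁ d∈top with ∈-map⁻ _ d∈top
...   | e , e∈L , refl = suc k , e , ≤-refl , e∈L , refl
∈-layers⁻ {q} {L} (suc k) d∈ | inj₂ d∈rest with ∈-layers⁻ k d∈rest
...   | j , e , j≤k , e∈L , refl = j , e , m≤n⇒m≤1+n j≤k , e∈L , refl

∈-layers⁺ : ∀ {q L e j} k → j ≤ k → e ∈ L → q ^ j * e ∈ layers q L k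
∈-layers⁺ zero z≤n e∈L = ∈-map⁺ _ e∈L
∈-layers⁺ {q} {L} {j = j} (suc k) j≤ e∈L with m≤n⇒m<n∨m≡n j≤
... | inj₂ refl         = ∈-++⁺ˡ (∈-map⁺ _ e∈L)
... | inj₁ (s≤s j≤k)    = ∈-++⁺ʳ (layer q L (suc k)) (∈-layers⁺ k j≤k e∈L)

layer-scale : ∀ q L i j → map (q ^ i *_) (layer q L j) ≡ layer q L (j + i)
layer-scale q L i j = trans (sym (ListProp.map-∘ L)) (ListProp.map-cong shift-power L)
  where
  shift-power : ∀ e → q ^ i * (q ^ j * e) ≡ q ^ (j + i) * e
  shift-power e = begin
    q ^ i * (q ^ j * e)  ≡⟨ sym (*-assoc (q ^ i) (q ^ j) e) ⟩
    q ^ i * q ^ j * e    ≡⟨ cong (_* e) (*-comm (q ^ i) (q ^ j)) ⟩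
    q ^ j * q ^ i * e    ≡⟨ cong (_* e) (sym (^-distribˡ-+-* q j i)) ⟩
    q ^ (j + i) * e      ∎
    where open ≡-Reasoning

consecutive-layers : ∀ q L m →
  map (q ^ suc m *_) (layers q L 1) ≡ layer q L (suc (suc m)) ++ layer q L (suc m)
consecutive-layers q L m =
  trans (ListProp.map-++ (q ^ suc m *_) (layer q L 1) (layer q L 0))
        (cong₂ _++_ (layer-scale q L (suc m) 1) (layer-scale q L (suc m) 0))

layers-odd-balanced : ∀ {q L} → Balanced (layers q L 1) → ∀ k → Balanced (layers q L (suc (2 * k)))
layers-odd-balanced b₁ zero = b₁
layers-odd-balanced {q} {L} b₁ (suc k) =
  subst (λ i → Balanced (layers q L (suc i))) (sym (*-suc 2 k)) two-more
  where
  m : ℕ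
  m = suc (2 * k)
  two-more : Balanced (layers q L (suc (suc m)))
  two-more = subst Balanced
    (trans (cong (_++ layers q L m) (consecutive-layers q L m))
           (ListProp.++-assoc (layer q L (suc (suc m))) (layer q L (suc m)) (layers q L m)))
    (Balanced-++ (Balanced-scale (q ^ suc m) b₁) (layers-odd-balanced b₁ k))

DivisorList : ℕ → List ℕ → Set
DivisorList n L = Unique L × (∀ {d} → d ∈ L ⇔ d ∣ n)

divisors-DivisorList : ∀ n .{{_ : NonZero n}} → DivisorList n (divisors n)
divisors-DivisorList n =
  Unique.filter⁺ (_∣? n) (Unique.applyUpTo⁺₁ suc n (λ i<j _ e → <⇒≢ i<j (suc-injective e))) ,
  mk⇔ (λ d∈ → proj₂ (∈-filter⁻ (_∣? n) {xs = applyUpTo suc n} d∈)) in-range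
  where
  in-range : ∀ {d} → d ∣ n → d ∈ divisors n
  in-range {zero}  0∣n = contradiction (0∣⇒≡0 0∣n) (≢-nonZero⁻¹ n)
  in-range {suc d} d∣n = ∈-filter⁺ (_∣? n) (∈-applyUpTo⁺ suc (∣⇒≤ d∣n)) d∣n

DivisorList-↭ : ∀ {n L M} → DivisorList n L → DivisorList n M → L ↭ M
DivisorList-↭ (uL , ∈L) (uM , ∈M) =
  ∼bag⇒↭ (unique∧set⇒bag uL uM (⇔.trans ∈L (⇔.sym ∈M)))

DivisorList-1 : DivisorList 1 (1 ∷ [])
DivisorList-1 = All.[] ∷ [] , mk⇔ (λ { (here refl) → ∣-refl }) (λ d∣1 → here (∣1⇒≡1 d∣1))

^-monoʳ-∣ : ∀ q {j k} → j ≤ k → q ^ j ∣ q ^ k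
^-monoʳ-∣ q {j} j≤k with m≤n⇒∃[o]m+o≡n j≤k
... | o , refl = divides (q ^ o) (trans (^-distribˡ-+-* q j o) (*-comm (q ^ j) (q ^ o)))

prime∣^⇒∣ : ∀ {q m} → Prime q → ∀ k → q ∣ m ^ k → q ∣ m
prime∣^⇒∣ pq zero    q∣1 = contradiction (subst Prime (∣1⇒≡1 q∣1) pq) ¬prime[1]
prime∣^⇒∣ {m = m} pq (suc k) q∣m^k+1 with euclidsLemma m (m ^ k) pq q∣m^k+1
... | inj₁ q∣m   = q∣m
... | inj₂ q∣m^k = prime∣^⇒∣ pq k q∣m^k

prime∤⇒coprime : ∀ {q d} → Prime q → ¬ q ∣ d → Coprime d q
prime∤⇒coprime pq q∤d (i∣d , i∣q) with prime⇒irreducible pq i∣q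
... | inj₁ i≡1  = i≡1
... | inj₂ refl = contradiction i∣d q∤d

divisor-of-*prime : ∀ {q n d} → Prime q → d ∣ n * q → d ∣ n ⊎ ∃ λ d′ → d ≡ q * d′ × d′ ∣ n
divisor-of-*prime {q} {n} {d} pq d∣nq with q ∣? d
... | yes (divides d′ refl) =
      inj₂ (d′ , *-comm d′ q , *-cancelʳ-∣ q {{prime⇒nonZero pq}} d∣nq)
... | no q∤d = inj₁ (coprime-divisor (prime∤⇒coprime pq q∤d) (subst (d ∣_) (*-comm n q) d∣nq))

divisor-of-*prime^ : ∀ {q} → Prime q → ∀ m k {d} → d ∣ m * q ^ k →
                     ∃₂ λ j e → j ≤ k × e ∣ m × d ≡ q ^ j * e
divisor-of-*prime^ pq m zero {d} d∣m =
  0 , d , z≤n , subst (d ∣_) (*-identityʳ m) d∣m , sym (*-identityˡ d)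
divisor-of-*prime^ {q} pq m (suc k) {d} d∣
  with divisor-of-*prime pq (subst (d ∣_) (m*[q*x]≡m*x*q m (q ^ k)) d∣)
  where m*[q*x]≡m*x*q : ∀ m x → m * (q * x) ≡ m * x * q
        m*[q*x]≡m*x*q m x = trans (cong (m *_) (*-comm q x)) (sym (*-assoc m x q))
... | inj₁ d∣mq^k with divisor-of-*prime^ pq m k d∣mq^k
...   | j , e , j≤k , e∣m , d≡ = j , e , m≤n⇒m≤1+n j≤k , e∣m , d≡
divisor-of-*prime^ {q} pq m (suc k) {d} d∣
    | inj₂ (d′ , refl , d′∣mq^k) with divisor-of-*prime^ pq m k d′∣mq^k
...   | j , e , j≤k , e∣m , refl = suc j , e , s≤s j≤k , e∣m , sym (*-assoc q (q ^ j) e)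

valuation-unique : ∀ {q u v} .{{_ : NonZero q}} → ¬ q ∣ u → ¬ q ∣ v →
                   ∀ a b → q ^ a * u ≡ q ^ b * v → a ≡ b
valuation-unique _ _ zero zero _ = refl
valuation-unique {q} {u} {v} q∤u _ zero (suc b) e =
  contradiction (subst (q ∣_) (sym (trans (sym (*-identityˡ u)) e)) (∣m⇒∣m*n v (m∣m*n (q ^ b)))) q∤u
valuation-unique {q} {u} {v} _ q∤v (suc a) zero e =
  contradiction (subst (q ∣_) (trans e (*-identityˡ v)) (∣m⇒∣m*n u (m∣m*n (q ^ a)))) q∤v
valuation-unique {q} {u} {v} q∤u q∤v (suc a) (suc b) e =
  cong suc (valuation-unique q∤u q∤v a b (*-cancelˡ-≡ (q ^ a * u) (q ^ b * v) q
    (trans (sym (*-assoc q (q ^ a) u)) (trans e (*-assoc q (q ^ b) v)))))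

layers-DivisorList : ∀ {q m L} → Prime q → ¬ q ∣ m → DivisorList m L →
                     ∀ k → DivisorList (m * q ^ k) (layers q L k)
layers-DivisorList {q} {m} {L} pq q∤m (unique-L , ∈L⇔) k = unique k , mk⇔ to from
  where
  instance
    q≢0 : NonZero q
    q≢0 = prime⇒nonZero pq

  q∤ : ∀ {e} → e ∈ L → ¬ q ∣ e
  q∤ e∈L q∣e = q∤m (∣-trans q∣e (Equivalence.to ∈L⇔ e∈L))

  to : ∀ {d} → d ∈ layers q L k → d ∣ m * q ^ k
  to d∈ with ∈-layers⁻ k d∈
  ... | j , e , j≤k , e∈L , refl =
        subst (q ^ j * e ∣_) (*-comm (q ^ k) m) (*-pres-∣ (^-monoʳ-∣ q j≤k) (Equivalence.to ∈L⇔ e∈L))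

  from : ∀ {d} → d ∣ m * q ^ k → d ∈ layers q L k
  from d∣ with divisor-of-*prime^ pq m k d∣
  ... | j , e , j≤k , e∣m , refl = ∈-layers⁺ k j≤k (Equivalence.from ∈L⇔ e∣m)

  unique-layer : ∀ j → Unique (layer q L j)
  unique-layer j = Unique.map⁺ (*-cancelˡ-≡ _ _ (q ^ j) {{m^n≢0 q j}}) unique-L

  -- the top layer is disjoint from the lower ones, by uniqueness of the valuation
  unique : ∀ k → Unique (layers q L k)
  unique zero    = unique-layer 0
  unique (suc k) = Unique.++⁺ (unique-layer (suc k)) (unique k) disjoint
    where
    disjoint : ∀ {x} → ¬ (x ∈ layer q L (suc k) × x ∈ layers q L k)
    disjoint (x∈top , x∈lower) with ∈-map⁻ _ x∈top | ∈-layers⁻ k x∈lower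
    ... | e , e∈L , refl | j , e′ , j≤k , e′∈L , eq =
          1+n≰n (subst (_≤ k) (sym (valuation-unique (q∤ e∈L) (q∤ e′∈L) (suc k) j eq)) j≤k)

-- The two bottom layers over a complete list P with odd total 2y + 1 balance for
-- any odd ratio p = 2r + 1 ≤ 2y + 1: one side takes p times a part of P of sum y
-- together with a part of P of sum r + y + 1, which is exactly half of (p + 1)(2y + 1).
two-layers-balanced : ∀ {P r y} → Complete P → sum P ≡ suc (2 * y) → r ≤ y →
                      Balanced (layers (suc (2 * r)) P 1)
two-layers-balanced {P} {r} {y} complete sumP≡ r≤y =
  half-Splits⇒Balanced (Splits-++ (Splits-scale (p ^ 1) (complete y y≤sum))
                                  (Splits-scale (p ^ 0) (complete (r + suc y) r+y+1≤sum)))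
                       halves
  where
  p : ℕ
  p = suc (2 * r)
  y≤sum : y ≤ sum P
  y≤sum = subst (y ≤_) (sym sumP≡) (≤-trans (m≤m+n y (y + 0)) (n≤1+n (2 * y)))
  r+y+1≤sum : r + suc y ≤ sum P
  r+y+1≤sum = subst (r + suc y ≤_) (trans (+-suc y (y + 0)) (sym sumP≡))
                (+-mono-≤ r≤y (s≤s (m≤m+n y 0)))
  -- the arithmetic core, with p ^ 1 = p * 1 and p ^ 0 = 1 unfolded
  identity : ∀ r y →
    (suc (2 * r) * 1 * y + 1 * (r + suc y)) + (suc (2 * r) * 1 * y + 1 * (r + suc y))
      ≡ (suc (2 * r) * 1 + 1) * suc (2 * y)
  identity = solve-∀
  halves : (p ^ 1 * y + p ^ 0 * (r + suc y)) + (p ^ 1 * y + p ^ 0 * (r + suc y)) ≡ sum (layers p P 1)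
  halves = trans (identity r y) (sym (trans (sum-layers p P 1) (cong ((p ^ 1 + 1) *_) sumP≡)))

layers-balanced⇒odd : ∀ {q L k} → 2 ∣ suc q → ¬ 2 ∣ sum L → Balanced (layers q L k) → OddNat k
layers-balanced⇒odd {q} {L} {k} 2∣q+1 2∤sumL balanced
  with euclidsLemma (geomSum q k) (sum L) prime[2]
         (subst (2 ∣_) (sum-layers q L k) (Balanced⇒2∣sum balanced))
... | inj₁ 2∣G    = geomSum-even⇒odd 2∣q+1 2∣G
... | inj₂ 2∣sumL = contradiction 2∣sumL 2∤sumL

-- If L has an element M exceeding half its total, the top element q ^ (k+1) · M of
-- the layers only fits into a balanced splitting when q ≤ sum L.
layers-balanced⇒ratio≤ : ∀ {q L M} k → M ∈ L → sum L < M + M →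
                         Balanced (layers q L (suc k)) → q ≤ sum L
layers-balanced⇒ratio≤ {q} {L} {M} k M∈L s<2M balanced =
  ≮⇒≥ (λ s<q → <⇒≱ (total<2·top s<q) (Balanced⇒≤half balanced top∈))
  where
  s : ℕ
  s = sum L
  Q : ℕ
  Q = q ^ suc k
  top∈ : Q * M ∈ layers q L (suc k)
  top∈ = ∈-layers⁺ (suc k) ≤-refl M∈L
  total<2·top : s < q → sum (layers q L (suc k)) < Q * M + Q * M
  total<2·top s<q = begin-strict
    sum (layers q L (suc k))  ≡⟨ sum-layers q L (suc k) ⟩
    (Q + geomSum q k) * s     ≡⟨ *-distribʳ-+ s Q (geomSum q k) ⟩
    Q * s + geomSum q k * s   <⟨ +-monoʳ-< (Q * s) (geomSum-bound k s<q) ⟩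
    Q * s + Q                 ≡⟨ trans (+-comm (Q * s) Q) (sym (*-suc Q s)) ⟩
    Q * suc s                 ≤⟨ *-monoʳ-≤ Q s<2M ⟩
    Q * (M + M)               ≡⟨ *-distribˡ-+ Q M M ⟩
    Q * M + Q * M             ∎
    where open ≤-Reasoning

layers-balanced⇔ : ∀ {P M} r k → Complete P → OddNat (sum P) → M ∈ P → sum P < M + M →
                   Balanced (layers (suc (2 * r)) P k) ⇔ (suc (2 * r) ≤ sum P × OddNat k)
layers-balanced⇔ {P} r k complete (y , sumP≡) M∈P s<2M = mk⇔ necessary sufficient
  where
  necessary : Balanced (layers (suc (2 * r)) P k) → suc (2 * r) ≤ sum P × OddNat k
  necessary balanced with layers-balanced⇒odd {k = k} (divides (suc r) (even r)) (odd⇒∤2 (y , sumP≡)) balanced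
    where even : ∀ r → suc (suc (2 * r)) ≡ suc r * 2
          even = solve-∀
  ... | j , k≡ =
    layers-balanced⇒ratio≤ (2 * j) M∈P s<2M (subst (λ i → Balanced (layers _ P i)) k≡ balanced) , j , k≡
  sufficient : suc (2 * r) ≤ sum P × OddNat k → Balanced (layers (suc (2 * r)) P k)
  sufficient (p≤sum , j , k≡) = subst (λ i → Balanced (layers _ P i)) (sym k≡)
    (layers-odd-balanced (two-layers-balanced complete sumP≡ r≤y) j)
    where r≤y : r ≤ y
          r≤y = *-cancelˡ-≤ 2 (≤-pred (subst (suc (2 * r) ≤_) sumP≡ p≤sum))

powersOfTwo : ℕ → List ℕ
powersOfTwo a = layers 2 (1 ∷ []) a

powersOfTwo-DivisorList : ∀ a → DivisorList (2 ^ a) (powersOfTwo a)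
powersOfTwo-DivisorList a = subst (λ m → DivisorList m (powersOfTwo a)) (*-identityˡ (2 ^ a))
  (layers-DivisorList prime[2] (odd⇒∤2 (0 , refl)) DivisorList-1 a)

sum-powersOfTwo : ∀ a → sum (powersOfTwo a) ≡ geomSum 2 a
sum-powersOfTwo a = trans (sum-layers 2 (1 ∷ []) a) (*-identityʳ (geomSum 2 a))

suc-geomSum-2 : ∀ a → suc (geomSum 2 a) ≡ 2 ^ suc a
suc-geomSum-2 a =
  trans (+-comm 1 (geomSum 2 a)) (trans (cong (_+ 1) (sym (*-identityʳ _))) (geomSum-closed 1 a))

geomSum-2-odd : ∀ a → OddNat (geomSum 2 a)
geomSum-2-odd zero = 0 , refl
geomSum-2-odd (suc a) with geomSum-2-odd a
... | k , G≡ = 2 ^ a + k , trans (cong (2 ^ suc a +_) G≡) (regroup (2 ^ a) k)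
  where regroup : ∀ x k → 2 * x + suc (2 * k) ≡ suc (2 * (x + k))
        regroup = solve-∀

-- Binary expansion: every number up to 2 ^ (a + 1) - 1 is a sum of distinct powers 2 ^ j, j ≤ a.
powersOfTwo-complete : ∀ a → Complete (powersOfTwo a)
powersOfTwo-complete zero    = complete-∷ complete-[] (s≤s z≤n)
powersOfTwo-complete (suc a) = complete-∷ (powersOfTwo-complete a) (≤-reflexive top≡)
  where top≡ : 2 ^ suc a * 1 ≡ suc (sum (powersOfTwo a))
        top≡ = trans (*-identityʳ _) (sym (trans (cong suc (sum-powersOfTwo a)) (suc-geomSum-2 a)))

geomSum-2<top+top : ∀ a → geomSum 2 a < 2 ^ a * 1 + 2 ^ a * 1
geomSum-2<top+top a = ≤-reflexive (trans (suc-geomSum-2 a) (double (2 ^ a)))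
  where double : ∀ x → 2 * x ≡ x * 1 + x * 1
        double = solve-∀

powersOfTwo-layers-balanced⇔ : ∀ r α β →
  Balanced (layers (suc (2 * r)) (powersOfTwo α) β) ⇔ (suc (2 * r) ≤ 2 ^ (α + 1) ∸ 1 × OddNat β)
powersOfTwo-layers-balanced⇔ r α β =
  subst (λ s → Balanced (layers (suc (2 * r)) (powersOfTwo α) β) ⇔ (suc (2 * r) ≤ s × OddNat β)) total≡
    (layers-balanced⇔ r β (powersOfTwo-complete α) odd-total (∈-layers⁺ α ≤-refl (here refl)) top>half)
  where
  odd-total : OddNat (sum (powersOfTwo α))
  odd-total = subst OddNat (sym (sum-powersOfTwo α)) (geomSum-2-odd α)
  top>half : sum (powersOfTwo α) < 2 ^ α * 1 + 2 ^ α * 1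
  top>half = subst (_< 2 ^ α * 1 + 2 ^ α * 1) (sym (sum-powersOfTwo α)) (geomSum-2<top+top α)
  total≡ : sum (powersOfTwo α) ≡ 2 ^ (α + 1) ∸ 1
  total≡ = trans (sum-powersOfTwo α) (cong (_∸ 1) (trans (suc-geomSum-2 α) (cong (2 ^_) (+-comm 1 α))))

odd-prime : ∀ {p} → Prime p → ¬ (p ≡ 2) → OddNat p
odd-prime {p} prime-p p≢2 = ∤2⇒odd 2∤p
  where
  2∤p : ¬ 2 ∣ p
  2∤p 2∣p with prime⇒irreducible prime-p 2∣p
  ... | inj₁ ()
  ... | inj₂ 2≡p = p≢2 (sym 2≡p)

odd-prime∤2^ : ∀ {p} → Prime p → ¬ (p ≡ 2) → ∀ a → ¬ p ∣ 2 ^ a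
odd-prime∤2^ prime-p p≢2 a p∣2^a with prime⇒irreducible prime[2] (prime∣^⇒∣ prime-p a p∣2^a)
... | inj₁ refl = contradiction prime-p ¬prime[1]
... | inj₂ refl = p≢2 refl

divisors-2^α*p^β : ∀ {p} α β → Prime p → ¬ (p ≡ 2) →
                   divisors (2 ^ α * p ^ β) ↭ layers p (powersOfTwo α) β
divisors-2^α*p^β {p} α β prime-p p≢2 =
  DivisorList-↭ (divisors-DivisorList (2 ^ α * p ^ β))
    (layers-DivisorList prime-p (odd-prime∤2^ prime-p p≢2 α) (powersOfTwo-DivisorList α) β)
  where
  instance
    p≢0 : NonZero p
    p≢0 = prime⇒nonZero prime-p
    n≢0 : NonZero (2 ^ α * p ^ β)
    n≢0 = m*n≢0 (2 ^ α) (p ^ β) {{m^n≢0 2 α}} {{m^n≢0 p β}}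

-- Main theorem. Write p = 2r + 1; Zumkeller (2 ^ α · p ^ β) means that the layers
-- of its divisors balance, which the criterion above decides.
mainTheorem1 : (p α β : ℕ) → Prime p → ¬ (p ≡ 2) → 1 ≤ α → 1 ≤ β
    → Zumkeller (2 ^ α * p ^ β) ⇔ (p ≤ 2 ^ (α + 1) ∸ 1 × OddNat β)
mainTheorem1 p α β prime-p p≢2 _ _ with odd-prime prime-p p≢2
... | r , refl = ⇔.trans zumkeller⇔balanced (powersOfTwo-layers-balanced⇔ r α β)
  where
  divisors↭layers : divisors (2 ^ α * p ^ β) ↭ layers p (powersOfTwo α) β
  divisors↭layers = divisors-2^α*p^β α β prime-p p≢2
  zumkeller⇔balanced : Zumkeller (2 ^ α * p ^ β) ⇔ Balanced (layers p (powersOfTwo α) β)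
  zumkeller⇔balanced = mk⇔ (Balanced-↭ divisors↭layers) (Balanced-↭ (↭-sym divisors↭layers))
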